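{- Fix an integer $n \ge 2$. For a nonnegative integer $N$, let $f(N)$ denote the maximal chromatic number of an $n$-uniform hypergraph with exactly $N$ edges (with $f(0)=1$). Then for every integer $N>0$ and every positive integer $p$, \[ f(N)\le \max\Big\{ f(a_1)+f(a_2)+\dots+f(a_p) \;:\; a_1,\dots,a_p \in \mathbb{Z}_{\ge 0},\ a_1+\dots+a_p\le N/p^{n-1}\Big\}. \]
   Context: A hypergraph $H=(V,E)$ consists of a finite vertex set $V$ and a family $E$ of subsets of $V$ (edges); it is $n$-uniform if every edge has exactly $n$ elements. A proper $r$-coloring is a map $V\to\{1,\dots,r\}$ under which no edge is monochromatic; the chromatic number is the least $r$ admitting a proper $r$-coloring. -}

module Defs where

open import Data.Nat using (ℕ; _≤_; _^_; _*_; _∸_)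
open import Data.Fin using (Fin)
open import Data.Fin.Subset using (Subset; _∈_; ∣_∣)
open import Data.List using (List; length)
open import Data.List.Relation.Unary.All using (All)
open import Data.List.Relation.Unary.Unique.Propositional using (Unique)
open import Data.Product using (Σ; ∃; _×_)
open import Relation.Binary.PropositionalEquality using (_≡_)
open import Relation.Nullary using (¬_)

record Hypergraph : Set where
  field
    nV     : ℕ
    edges  : List (Subset nV)
    distinct : Unique edges
open Hypergraph public

Uniform : ℕ → Hypergraph → Set
Uniform n H = All (λ e → ∣ e ∣ ≡ n) (edges H)

numEdges : Hypergraph → ℕ
numEdges H = length (edges H)

Monochromatic : ∀ {v r} → (Fin v → Fin r) → Subset v → Set
Monochromatic {v} {r} c e = Σ (Fin r) λ k → ∀ (x : Fin v) → x ∈ e → c x ≡ k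

ProperColoring : (H : Hypergraph) (r : ℕ) → (Fin (nV H) → Fin r) → Set
ProperColoring H r c = All (λ e → ¬ Monochromatic c e) (edges H)

Colorable : Hypergraph → ℕ → Set
Colorable H r = Σ (Fin (nV H) → Fin r) (ProperColoring H r)

ChromaticNumber : Hypergraph → ℕ → Set
ChromaticNumber H k = Colorable H k × (∀ r → Colorable H r → k ≤ r)

IsMaxChromatic : ℕ → (ℕ → ℕ) → Set
IsMaxChromatic n f = ∀ N →
  (Σ Hypergraph λ H → Uniform n H × numEdges H ≡ N × ChromaticNumber H (f N))
  × (∀ H k → Uniform n H → numEdges H ≡ N → ChromaticNumber H k → k ≤ f N)

module Submission where

-- Proof idea (a derandomised first-moment argument; it only needs n ≥ 1 and p ≥ 1).
-- Let H be an extremal n-uniform hypergraph, with N edges on v vertices and χ(H) = f(N),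
-- and colour its vertices by a map w : V → Fin p.  An edge e is constant of colour c for exactly p^(v-n) of the p^v maps w, so summed
-- over all w and all colours c there are N·p·p^(v-n) (edge, colour) pairs with e
-- monochromatic in colour c.  Hence some w has at most N / p^(n-1) monochromatic edges.
-- For this w let H_i be the sub-hypergraph of edges monochromatic in colour i and a_i its
-- number of edges, so p^(n-1)·Σ a_i ≤ N.  Each H_i is n-uniform and, being part of the
-- colourable H, colourable; so it has a chromatic number, which is at most f(a_i).
-- Colouring x by the pair (w x, colour of x in H_(w x)) is proper for H and uses
-- Σ f(a_i) colours, whence f(N) = χ(H) ≤ Σ f(a_i).

open import Defs
open import Data.Nat using (ℕ; _≤_; _<_; _^_; _*_; _∸_)
open import Data.Vec using (Vec; sum; map)
open import Data.Product using (Σ; _×_)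

open import Data.Nat using (zero; suc; _+_; z≤n; NonZero; _≤?_)
open import Data.Nat.Properties
  using (+-*-semiring; +-identityʳ; *-zeroʳ; *-assoc; *-distribˡ-+; +-mono-≤; +-monoʳ-≤;
         *-monoʳ-≤; *-cancelˡ-≤; ≤-refl; ≤-trans; ≤-reflexive; ≤-pred; <⇒≤; ≰⇒>; ≮⇒≥;
         m≤n⇒m<n∨m≡n; m^n≢0; module ≤-Reasoning)
open import Data.Nat.Solver using (module +-*-Solver)
open import Algebra.Properties.Semiring.Sum +-*-semiring
  using (sum-syntax; sum-cong-≗; ∑-distrib-+; *-distribˡ-sum; sum-replicate-zero)
open import Data.Bool using (Bool; true; false; _∧_; T; if_then_else_)
open import Data.Bool.Properties using (T?)
open import Data.Unit using (tt)
open import Data.Empty using (⊥-elim)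
open import Data.Sum using (_⊎_; inj₁; inj₂; [_,_]′)
open import Data.Product using (∃; _,_; proj₁; proj₂)
import Data.Product as Product
open import Data.Fin using (Fin; zero; suc; _≟_; inject≤; _↑ˡ_; _↑ʳ_; splitAt)
open import Data.Fin.Properties using (any?; all?; inject≤-injective; splitAt-↑ˡ; splitAt-↑ʳ)
open import Data.Fin.Subset using (Subset; ∣_∣; _∈_; Nonempty)
open import Data.Fin.Subset.Properties using (_∈?_)
open import Data.Vec using ([]; _∷_; lookup; tabulate; here; there)
open import Data.Vec.Properties using (lookup∘tabulate; lookup-map)
open import Data.Vec.Functional using (tail) renaming (_∷_ to _◂_)
open import Data.List using (List; []; _∷_; length; filter)
open import Data.List.Relation.Unary.All as All using (All; []; _∷_)
import Data.List.Relation.Unary.All.Properties as AllP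
import Data.List.Relation.Unary.Unique.Propositional.Properties as Unique
open import Data.List.Membership.Propositional using () renaming (_∈_ to _∈ₗ_)
open import Data.List.Membership.Propositional.Properties using (∈-filter⁺)
open import Relation.Nullary using (Dec; yes; no; does; ¬_; ¬?)
open import Relation.Nullary.Decidable using (_→-dec_)
open import Relation.Binary.PropositionalEquality
  using (_≡_; refl; sym; trans; cong; cong₂; subst; subst₂; module ≡-Reasoning)

𝟙 : Bool → ℕ
𝟙 true  = 1
𝟙 false = 0

∑-const : ∀ p x → ∑[ i < p ] x ≡ p * x
∑-const zero    x = refl
∑-const (suc p) x = cong (x +_) (∑-const p x)

∑-mono : ∀ p {g h : Fin p → ℕ} → (∀ i → g i ≤ h i) → ∑[ i < p ] g i ≤ ∑[ i < p ] h i
∑-mono zero    g≤h = z≤n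
∑-mono (suc p) g≤h = +-mono-≤ (g≤h zero) (∑-mono p (λ i → g≤h (suc i)))

∑-δ : ∀ p (c : Fin p) x → ∑[ d < p ] (if does (d ≟ c) then x else 0) ≡ x
∑-δ (suc p) zero    x = trans (cong (x +_) (sum-replicate-zero p)) (+-identityʳ x)
∑-δ (suc p) (suc c) x = ∑-δ p c x

∑-argmin : ∀ q (h : Fin (suc q) → ℕ) → ∃ λ c → suc q * h c ≤ ∑[ i < suc q ] h i
∑-argmin zero    h = zero , ≤-refl
∑-argmin (suc q) h with ∑-argmin q (λ i → h (suc i))
... | c , avg with h zero ≤? h (suc c)
...   | yes h₀≤ = zero , +-monoʳ-≤ (h zero) (≤-trans (*-monoʳ-≤ (suc q) h₀≤) avg)
...   | no  h₀≰ = suc c , +-mono-≤ (<⇒≤ (≰⇒> h₀≰)) avg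

sum-tabulate : ∀ p (h : Fin p → ℕ) → sum (tabulate h) ≡ ∑[ i < p ] h i
sum-tabulate zero    h = refl
sum-tabulate (suc p) h = cong (h zero +_) (sum-tabulate p (λ i → h (suc i)))

∑all : ∀ p v → ((Fin v → Fin p) → ℕ) → ℕ
∑all p zero    g = g (λ ())
∑all p (suc v) g = ∑[ c < p ] ∑all p v (λ w → g (c ◂ w))

∑all-cong : ∀ p v {g h : (Fin v → Fin p) → ℕ} → (∀ w → g w ≡ h w) → ∑all p v g ≡ ∑all p v h
∑all-cong p zero    g≗h = g≗h _
∑all-cong p (suc v) g≗h = sum-cong-≗ {p} (λ c → ∑all-cong p v (λ w → g≗h (c ◂ w)))

∑all-zero : ∀ p v → ∑all p v (λ _ → 0) ≡ 0
∑all-zero p zero    = refl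
∑all-zero p (suc v) = begin
    ∑[ c < p ] ∑all p v (λ _ → 0)  ≡⟨ sum-cong-≗ {p} (λ _ → ∑all-zero p v) ⟩
    ∑[ c < p ] 0                   ≡⟨ sum-replicate-zero p ⟩
    0                              ∎
  where open ≡-Reasoning

∑all-+ : ∀ p v (g h : (Fin v → Fin p) → ℕ) →
  ∑all p v (λ w → g w + h w) ≡ ∑all p v g + ∑all p v h
∑all-+ p zero    g h = refl
∑all-+ p (suc v) g h =
  trans (sum-cong-≗ {p} (λ c → ∑all-+ p v (λ w → g (c ◂ w)) (λ w → h (c ◂ w))))
        (∑-distrib-+ {p} _ _)

∑all-∑ : ∀ p v q (g : Fin q → (Fin v → Fin p) → ℕ) →
  ∑all p v (λ w → ∑[ c < q ] g c w) ≡ ∑[ c < q ] ∑all p v (g c)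
∑all-∑ p v zero    g = ∑all-zero p v
∑all-∑ p v (suc q) g =
  trans (∑all-+ p v _ _) (cong (∑all p v (g zero) +_) (∑all-∑ p v q (λ c → g (suc c))))

∑all-argmin : ∀ q v (g : (Fin v → Fin (suc q)) → ℕ) →
  ∃ λ w → suc q ^ v * g w ≤ ∑all (suc q) v g
∑all-argmin q zero    g = (λ ()) , ≤-reflexive (+-identityʳ _)
∑all-argmin q (suc v) g =
  let best c = proj₁ (∑all-argmin q v (λ w → g (c ◂ w)))
      (c , avg) = ∑-argmin q (λ c → suc q ^ v * g (c ◂ best c))
  in c ◂ best c
   , ≤-trans (≤-reflexive (*-assoc (suc q) (suc q ^ v) _))
       (≤-trans avg (∑-mono (suc q) (λ d → proj₂ (∑all-argmin q v (λ w → g (d ◂ w))))))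

constOn : ∀ {p v} → Fin p → (Fin v → Fin p) → Subset v → Bool
constOn c w []          = true
constOn c w (true  ∷ e) = does (w zero ≟ c) ∧ constOn c (tail w) e
constOn c w (false ∷ e) = constOn c (tail w) e

constOn-complete : ∀ {p v} (c : Fin p) (w : Fin v → Fin p) e →
  (∀ x → x ∈ e → w x ≡ c) → T (constOn c w e)
constOn-complete c w []          _ = tt
constOn-complete c w (true ∷ e)  const with w zero ≟ c
... | yes _   = constOn-complete c (tail w) e (λ x x∈e → const (suc x) (there x∈e))
... | no  w≢c = w≢c (const zero here)
constOn-complete c w (false ∷ e) const =
  constOn-complete c (tail w) e (λ x x∈e → const (suc x) (there x∈e))

count-constOn : ∀ p v (c : Fin p) (e : Subset v) →
  p ^ ∣ e ∣ * ∑all p v (λ w → 𝟙 (constOn c w e)) ≡ p ^ v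
count-constOn p zero    c []         = refl
count-constOn p (suc v) c (true ∷ e) = begin
    p * p ^ ∣ e ∣ * ∑[ d < p ] ∑all p v (λ w → 𝟙 (does (d ≟ c) ∧ constOn c w e))
  ≡⟨ cong (p * p ^ ∣ e ∣ *_) (trans (sum-cong-≗ {p} onlyColourC) (∑-δ p c _)) ⟩
    p * p ^ ∣ e ∣ * ∑all p v (λ w → 𝟙 (constOn c w e))
  ≡⟨ *-assoc p _ _ ⟩
    p * (p ^ ∣ e ∣ * ∑all p v (λ w → 𝟙 (constOn c w e)))
  ≡⟨ cong (p *_) (count-constOn p v c e) ⟩
    p * p ^ v
  ∎
  where
  open ≡-Reasoning
  -- only maps giving vertex 0 the colour c contribute
  onlyColourC : ∀ d → ∑all p v (λ w → 𝟙 (does (d ≟ c) ∧ constOn c w e))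
                    ≡ (if does (d ≟ c) then ∑all p v (λ w → 𝟙 (constOn c w e)) else 0)
  onlyColourC d with does (d ≟ c)
  ... | true  = refl
  ... | false = ∑all-zero p v
count-constOn p (suc v) c (false ∷ e) = begin
    p ^ ∣ e ∣ * ∑[ d < p ] ∑all p v (λ w → 𝟙 (constOn c w e))
  ≡⟨ cong (p ^ ∣ e ∣ *_) (∑-const p _) ⟩
    p ^ ∣ e ∣ * (p * ∑all p v (λ w → 𝟙 (constOn c w e)))
  ≡⟨ solve 3 (λ a b x → a :* (b :* x) := b :* (a :* x)) refl (p ^ ∣ e ∣) p _ ⟩
    p * (p ^ ∣ e ∣ * ∑all p v (λ w → 𝟙 (constOn c w e)))
  ≡⟨ cong (p *_) (count-constOn p v c e) ⟩
    p * p ^ v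
  ∎
  where
  open ≡-Reasoning
  open +-*-Solver

monoEdges : ∀ {p v} → (Fin v → Fin p) → Fin p → List (Subset v) → List (Subset v)
monoEdges w c = filter (λ e → T? (constOn c w e))

length-monoEdges-∷ : ∀ {p v} (w : Fin v → Fin p) c e E →
  length (monoEdges w c (e ∷ E)) ≡ 𝟙 (constOn c w e) + length (monoEdges w c E)
length-monoEdges-∷ w c e E with constOn c w e
... | true  = refl
... | false = refl

monoColourings-edge : ∀ p v n (e : Subset v) → ∣ e ∣ ≡ n →
  p ^ n * ∑all p v (λ w → ∑[ c < p ] 𝟙 (constOn c w e)) ≡ p * p ^ v
monoColourings-edge p v n e refl = begin
    p ^ ∣ e ∣ * ∑all p v (λ w → ∑[ c < p ] 𝟙 (constOn c w e))
  ≡⟨ cong (p ^ ∣ e ∣ *_) (∑all-∑ p v p (λ c w → 𝟙 (constOn c w e))) ⟩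
    p ^ ∣ e ∣ * ∑[ c < p ] ∑all p v (λ w → 𝟙 (constOn c w e))
  ≡⟨ *-distribˡ-sum {p} (p ^ ∣ e ∣) _ ⟩
    ∑[ c < p ] (p ^ ∣ e ∣ * ∑all p v (λ w → 𝟙 (constOn c w e)))
  ≡⟨ sum-cong-≗ {p} (λ c → count-constOn p v c e) ⟩
    ∑[ c < p ] (p ^ v)
  ≡⟨ ∑-const p _ ⟩
    p * p ^ v
  ∎
  where open ≡-Reasoning

monoColourings : ∀ p v n (E : List (Subset v)) → All (λ e → ∣ e ∣ ≡ n) E →
  p ^ n * ∑all p v (λ w → ∑[ c < p ] length (monoEdges w c E)) ≡ length E * (p * p ^ v)
monoColourings p v n [] [] = begin
    p ^ n * ∑all p v (λ w → ∑[ c < p ] 0)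
  ≡⟨ cong (p ^ n *_) (trans (∑all-cong p v (λ _ → sum-replicate-zero p)) (∑all-zero p v)) ⟩
    p ^ n * 0
  ≡⟨ *-zeroʳ (p ^ n) ⟩
    0
  ∎
  where open ≡-Reasoning
monoColourings p v n (e ∷ E) (∣e∣≡n ∷ uniform) = begin
    p ^ n * ∑all p v (λ w → ∑[ c < p ] length (monoEdges w c (e ∷ E)))
  ≡⟨ cong (p ^ n *_) (trans (∑all-cong p v splitFirst) (∑all-+ p v _ _)) ⟩
    p ^ n * (∑all p v onE + ∑all p v onRest)
  ≡⟨ *-distribˡ-+ (p ^ n) _ _ ⟩
    p ^ n * ∑all p v onE + p ^ n * ∑all p v onRest
  ≡⟨ cong₂ _+_ (monoColourings-edge p v n e ∣e∣≡n) (monoColourings p v n E uniform) ⟩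
    p * p ^ v + length E * (p * p ^ v)
  ∎
  where
  open ≡-Reasoning
  onE onRest : (Fin v → Fin p) → ℕ
  onE    w = ∑[ c < p ] 𝟙 (constOn c w e)
  onRest w = ∑[ c < p ] length (monoEdges w c E)
  splitFirst : ∀ w → ∑[ c < p ] length (monoEdges w c (e ∷ E)) ≡ onE w + onRest w
  splitFirst w = trans (sum-cong-≗ {p} (λ c → length-monoEdges-∷ w c e E)) (∑-distrib-+ {p} _ _)

fewMonochromatic : ∀ q n {v} (E : List (Subset v)) → All (λ e → ∣ e ∣ ≡ suc n) E →
  ∃ λ w → suc q ^ n * ∑[ c < suc q ] length (monoEdges w c E) ≤ length E
fewMonochromatic q n {v} E uniform = w , *-cancelˡ-≤ p (*-cancelˡ-≤ (p ^ v) (begin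
    p ^ v * (p * (p ^ n * g w))
  ≡⟨ solve 4 (λ a b c d → a :* (b :* (c :* d)) := (b :* c) :* (a :* d)) refl (p ^ v) p (p ^ n) (g w) ⟩
    p ^ suc n * (p ^ v * g w)
  ≤⟨ *-monoʳ-≤ (p ^ suc n) belowAverage ⟩
    p ^ suc n * ∑all p v g
  ≡⟨ monoColourings p v (suc n) E uniform ⟩
    length E * (p * p ^ v)
  ≡⟨ solve 3 (λ a b c → a :* (b :* c) := c :* (b :* a)) refl (length E) p (p ^ v) ⟩
    p ^ v * (p * length E)
  ∎))
  where
  open ≤-Reasoning
  open +-*-Solver
  p : ℕ
  p = suc q
  g : (Fin v → Fin p) → ℕ
  g w = ∑[ c < p ] length (monoEdges w c E)
  w : Fin v → Fin p
  w = proj₁ (∑all-argmin q v g)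
  belowAverage : p ^ v * g w ≤ ∑all p v g
  belowAverage = proj₂ (∑all-argmin q v g)
  instance
    p^v≢0 : NonZero (p ^ v)
    p^v≢0 = m^n≢0 p v

module _ {P : ℕ → Set} (P? : ∀ r → Dec (P r)) where

  Least : ℕ → Set
  Least k = P k × (∀ r → P r → k ≤ r)

  leastBelow : ∀ m → (∃ Least) ⊎ (∀ r → r < m → ¬ P r)
  leastBelow zero = inj₂ (λ _ ())
  leastBelow (suc m) with leastBelow m
  ... | inj₁ found = inj₁ found
  ... | inj₂ none with P? m
  ...   | yes pm  = inj₁ (m , pm , λ r pr → ≮⇒≥ (λ r<m → none r r<m pr))
  ...   | no  ¬pm = inj₂ λ r r<1+m pr →
          [ (λ r<m → none r r<m pr) , (λ { refl → ¬pm pr }) ]′ (m≤n⇒m<n∨m≡n (≤-pred r<1+m))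

  least : ∀ m → P m → ∃ Least
  least m pm with leastBelow (suc m)
  ... | inj₁ found = found
  ... | inj₂ none  = ⊥-elim (none m ≤-refl pm)

decMap : ∀ v {r} (P : (Fin v → Fin r) → Set) → (∀ {f g} → (∀ i → f i ≡ g i) → P f → P g) →
  (∀ f → Dec (P f)) → Dec (∃ P)
decMap zero P resp P? with P? (λ ())
... | yes p  = yes (_ , p)
... | no  ¬p = no λ (f , pf) → ¬p (resp (λ ()) pf)
decMap (suc v) P resp P? with any? (λ c → decMap v (λ g → P (c ◂ g))
                                   (λ f≗g → resp (λ { zero → refl ; (suc i) → f≗g i }))
                                   (λ g → P? (c ◂ g)))
... | yes (c , g , pg) = yes (c ◂ g , pg)
... | no  none         =
  no λ (f , pf) → none (f zero , tail f , resp (λ { zero → refl ; (suc i) → refl }) pf)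

monochromatic? : ∀ {v r} (c : Fin v → Fin r) e → Dec (Monochromatic c e)
monochromatic? c e = any? (λ k → all? (λ x → (x ∈? e) →-dec (c x ≟ k)))

colorable? : ∀ G r → Dec (Colorable G r)
colorable? G r = decMap (nV G) (ProperColoring G r)
  (λ c≗c′ → All.map (λ ¬mono (k , mono) → ¬mono (k , λ x x∈e → trans (c≗c′ x) (mono x x∈e))))
  (λ c → All.all? (λ e → ¬? (monochromatic? c e)) (edges G))

chromaticNumber : ∀ G r → Colorable G r → ∃ (ChromaticNumber G)
chromaticNumber G r = least (colorable? G) r

size⇒nonempty : ∀ {v m} (e : Subset v) → ∣ e ∣ ≡ suc m → Nonempty e
size⇒nonempty (true  ∷ e) _    = zero , here
size⇒nonempty (false ∷ e) size = Product.map suc there (size⇒nonempty e size)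

-- Enlarging the palette: for hypergraphs with nonempty edges an injective change of
-- colours keeps a colouring proper, so k ≤ K colours suffice whenever k do.
colorable-mono : ∀ G {n k K} → Uniform (suc n) G → k ≤ K → Colorable G k → Colorable G K
colorable-mono G {K = K} uniform k≤K (c , proper) =
  c′ , All.zipWith (λ (size , ¬mono) → stillProper _ (size⇒nonempty _ size) ¬mono)
                   (uniform , proper)
  where
  c′ : Fin (nV G) → Fin K
  c′ x = inject≤ (c x) k≤K
  stillProper : ∀ e → Nonempty e → ¬ Monochromatic c e → ¬ Monochromatic c′ e
  stillProper e (x₀ , x₀∈e) ¬mono (_ , mono) = ¬mono (c x₀ , λ x x∈e →
    inject≤-injective k≤K k≤K _ _ (trans (mono x x∈e) (sym (mono x₀ x₀∈e))))

colorable-by-f : ∀ n f → IsMaxChromatic (suc n) f → ∀ G r →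
  Uniform (suc n) G → Colorable G r → Colorable G (f (numEdges G))
colorable-by-f n f isMax G r uniform colourable =
  let (k , χ) = chromaticNumber G r colourable
  in colorable-mono G uniform (proj₂ (isMax (numEdges G)) G k uniform refl χ) (proj₁ χ)

colourClass : (H : Hypergraph) {p : ℕ} → (Fin (nV H) → Fin p) → Fin p → Hypergraph
colourClass H w i = record
  { nV = nV H ; edges = monoEdges w i (edges H)
  ; distinct = Unique.filter⁺ (λ e → T? (constOn i w e)) (distinct H) }

colourClass-uniform : ∀ H {n p} (w : Fin (nV H) → Fin p) i →
  Uniform n H → Uniform n (colourClass H w i)
colourClass-uniform H w i = AllP.filter⁺ (λ e → T? (constOn i w e))

colourClass-colorable : ∀ H {r p} (w : Fin (nV H) → Fin p) i →
  Colorable H r → Colorable (colourClass H w i) r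
colourClass-colorable H w i (c , proper) = c , AllP.filter⁺ (λ e → T? (constOn i w e)) proper

-- Fin (sum ks) as the disjoint union of blocks Fin (lookup ks i).
inBlock : ∀ {p} (ks : Vec ℕ p) (i : Fin p) → Fin (lookup ks i) → Fin (sum ks)
inBlock (k ∷ ks) zero    j = j ↑ˡ sum ks
inBlock (k ∷ ks) (suc i) j = k ↑ʳ inBlock ks i j

blockOf : ∀ {p} (ks : Vec ℕ p) → Fin (sum ks) → Σ (Fin p) λ i → Fin (lookup ks i)
blockOf (k ∷ ks) x =
  [ (λ j → zero , j) , (λ y → Product.map suc (λ j → j) (blockOf ks y)) ]′ (splitAt k x)

blockOf-inBlock : ∀ {p} (ks : Vec ℕ p) i j → blockOf ks (inBlock ks i j) ≡ (i , j)
blockOf-inBlock (k ∷ ks) zero    j rewrite splitAt-↑ˡ k j (sum ks) = refl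
blockOf-inBlock (k ∷ ks) (suc i) j
  rewrite splitAt-↑ʳ k (sum ks) (inBlock ks i j) | blockOf-inBlock ks i j = refl

graph-≡ : ∀ {A : Set} {B : A → Set} (f : (a : A) → B a) {a b y} →
  _≡_ {A = Σ A B} (a , f a) (b , y) → f b ≡ y
graph-≡ f refl = refl

glue : ∀ H {p} (w : Fin (nV H) → Fin p) (ks : Vec ℕ p) →
  (∀ i → Colorable (colourClass H w i) (lookup ks i)) → Colorable H (sum ks)
glue H {p} w ks classColouring = colour , All.tabulate notMonochromatic
  where
  c : ∀ i → Fin (nV H) → Fin (lookup ks i)
  c i = proj₁ (classColouring i)
  colour : Fin (nV H) → Fin (sum ks)
  colour x = inBlock ks (w x) (c (w x) x)
  notMonochromatic : ∀ {e} → e ∈ₗ edges H → ¬ Monochromatic colour e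
  notMonochromatic {e} e∈H (k , mono) =
    All.lookup (proj₂ (classColouring i)) e∈class
      (j , λ x x∈e → graph-≡ (λ i′ → c i′ x) (sameBlock x x∈e))
    where
    i : Fin p
    i = proj₁ (blockOf ks k)
    j : Fin (lookup ks i)
    j = proj₂ (blockOf ks k)
    sameBlock : ∀ x → x ∈ e → (w x , c (w x) x) ≡ (i , j)
    sameBlock x x∈e = trans (sym (blockOf-inBlock ks (w x) _)) (cong (blockOf ks) (mono x x∈e))
    e∈class : e ∈ₗ edges (colourClass H w i)
    e∈class = ∈-filter⁺ (λ e → T? (constOn i w e)) e∈H
      (constOn-complete i w e (λ x x∈e → cong proj₁ (sameBlock x x∈e)))

lemma1 : (n : ℕ) → 2 ≤ n → (f : ℕ → ℕ) → IsMaxChromatic n f →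
    (N : ℕ) → 0 < N → (p : ℕ) → 0 < p →
    Σ (Vec ℕ p) λ a → (p ^ (n ∸ 1)) * sum a ≤ N × f N ≤ sum (map f a)
lemma1 (suc n) _ f isMax N _ (suc q) _ with proj₁ (isMax N)
... | H , uniform , |H|≡N , (colourable , χH-least)
  with fewMonochromatic q n (edges H) uniform
...   | w , few = a , fewEdges , χH-least (sum (map f a)) (glue H w (map f a) classColouring)
  where
  classSize : Fin (suc q) → ℕ
  classSize i = numEdges (colourClass H w i)
  a : Vec ℕ (suc q)
  a = tabulate classSize
  fewEdges : suc q ^ n * sum a ≤ N
  fewEdges = subst₂ _≤_ (cong (suc q ^ n *_) (sym (sum-tabulate (suc q) classSize))) |H|≡N few
  classColouring : ∀ i → Colorable (colourClass H w i) (lookup (map f a) i)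
  classColouring i = subst (Colorable (colourClass H w i))
    (sym (trans (lookup-map i f a) (cong f (lookup∘tabulate classSize i))))
    (colorable-by-f n f isMax (colourClass H w i) (f N) (colourClass-uniform H w i uniform)
      (colourClass-colorable H w i colourable))
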